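{- For every integer $n\ge 4$ there exists a permutation $\tau\in\Sigma_n$ such that there is no odd positive integer $m$ for which the $n$-tuple $(m,S(m),S^2(m),\dots,S^{n-1}(m))$ has distinct coordinates and permutation pattern $\tau$.
   Context: The Syracuse function $S$ on odd positive integers is defined by $S(m)=(3m+1)/2^e$, where $e$ is the largest integer with $2^e\mid 3m+1$; $S^j$ is its $j$th iterate. $\Sigma_n$ is the group of permutations of $\{1,\dots,n\}$. For an $n$-tuple $X=(x_1,\dots,x_n)$ of distinct reals with coordinates in increasing order $y_1<\dots<y_n$, the permutation pattern of $X$ is the unique $\sigma\in\Sigma_n$ with $x_i=y_{\sigma(i)}$ for all $i$. -}

module Defs where

open import Data.Nat using (ℕ; zero; suc; _+_; _*_; _^_; _<_)
open import Data.Nat.Divisibility using (_∣_; _∣?_)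
open import Data.Nat.DivMod using (_/_)
open import Data.Fin using (Fin; toℕ)
open import Data.Fin.Permutation using (Permutation′; _⟨$⟩ʳ_)
open import Data.Product using (∃; _×_)
open import Relation.Binary.PropositionalEquality using (_≡_)
open import Relation.Nullary using (¬_; yes; no)
open import Function.Definitions using (Injective)

-- Remove all factors 2 from x, using at most `fuel` halving steps.
-- For x ≥ 1, fuel = x suffices (the 2-adic valuation of x is < x).
halveAll : ℕ → ℕ → ℕ
halveAll zero    x = x
halveAll (suc k) x with 2 ∣? x
... | yes _ = halveAll k (x / 2)
... | no  _ = x

oddPart : ℕ → ℕ
oddPart x = halveAll x x

S : ℕ → ℕ
S m = oddPart (3 * m + 1)

iter : ℕ → (ℕ → ℕ) → ℕ → ℕ
iter zero    f x = x
iter (suc j) f x = f (iter j f x)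

orbitTuple : (n : ℕ) → ℕ → Fin n → ℕ
orbitTuple n m i = iter (toℕ i) S m

Odd : ℕ → Set
Odd m = ¬ (2 ∣ m)

StrictlyIncreasing : {n : ℕ} → (Fin n → ℕ) → Set
StrictlyIncreasing {n} y = ∀ (i j : Fin n) → toℕ i < toℕ j → y i < y j

HasPattern : {n : ℕ} → (Fin n → ℕ) → Permutation′ n → Set
HasPattern {n} x σ =
  Injective _≡_ _≡_ x ×
  ∃ λ (y : Fin n → ℕ) → StrictlyIncreasing y × (∀ i → x i ≡ y (σ ⟨$⟩ʳ i))

-- Take the pattern of the 3-cycle on the first three positions, i.e. the orbit order
-- S²m < m < Sm < S³m. An ascent m < Sm forces 3m+1 ≡ 2 (mod 4), i.e. 2·Sm = 3m+1,
-- since otherwise Sm ≤ (3m+1)/4 < m. As 2·S(a) ≤ 3a+1 for every odd a, the descent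
-- S²m < m then gives 2·S³m ≤ 3·S²m + 1 < 3m + 1 = 2·Sm, contradicting Sm < S³m.
module Submission where

open import Defs
open import Data.Nat using (ℕ; _≤_; _<_)
open import Data.Fin.Permutation using (Permutation′)
open import Data.Product using (∃; _×_)
open import Relation.Nullary using (¬_)

open import Data.Nat using (zero; suc; _+_; _*_; z≤n; s≤s; z<s)
open import Data.Nat.Properties
open import Data.Nat.Divisibility using (_∣_; _∣?_; divides; ∣m∣n⇒∣m+n)
open import Data.Nat.DivMod using (_/_; m/n≤m; m/n<m; m/n*n≡m)
open import Data.Nat.Solver using (module +-*-Solver)
open import Data.Fin using (Fin; toℕ)
open import Data.Fin.Patterns using (0F; 1F; 2F; 3F)
open import Data.Fin.Permutation using (_⟨$⟩ʳ_; _∘ₚ_; transpose)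
open import Data.Product using (_,_)
open import Data.Sum using (_⊎_; inj₁; inj₂)
open import Data.Empty using (⊥-elim)
open import Relation.Nullary using (yes; no)
open import Relation.Binary.PropositionalEquality
  using (_≡_; refl; sym; cong; subst; subst₂; module ≡-Reasoning)
open +-*-Solver

halveAll-≤ : ∀ k x → halveAll k x ≤ x
halveAll-≤ zero    x = ≤-refl
halveAll-≤ (suc k) x with 2 ∣? x
... | yes _ = ≤-trans (halveAll-≤ k (x / 2)) (m/n≤m x 2)
... | no  _ = ≤-refl

halveAll-odd : ∀ k x → 0 < x → x ≤ k → Odd (halveAll k x)
halveAll-odd zero    x       0<x x≤0 _ = <-irrefl refl (≤-trans 0<x x≤0)
halveAll-odd (suc k) (suc x) _   1+x≤1+k with 2 ∣? suc x
... | no  2∤x = 2∤x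
... | yes 2∣x = halveAll-odd k (suc x / 2) 0<half half≤k
  where
  0<half : 0 < suc x / 2
  0<half with suc x / 2 | m/n*n≡m {suc x} {2} 2∣x
  ... | suc _ | _ = z<s
  half≤k : suc x / 2 ≤ k
  half≤k = ≤-pred (≤-trans (m/n<m (suc x) 2 (s≤s z<s)) 1+x≤1+k)

0<3m+1 : ∀ m → 0 < 3 * m + 1
0<3m+1 m = subst (0 <_) (+-comm 1 (3 * m)) z<s

S-odd : ∀ m → Odd (S m)
S-odd m = halveAll-odd (3 * m + 1) (3 * m + 1) (0<3m+1 m) ≤-refl

oddPart-even : ∀ x → 2 ∣ x → oddPart x * 2 ≡ x ⊎ oddPart x * 4 ≤ x
oddPart-even zero _ = inj₁ refl
oddPart-even (suc x) 2∣x with 2 ∣? suc x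
... | no 2∤x = ⊥-elim (2∤x 2∣x)
oddPart-even (suc zero)    _ | yes 2∣x = inj₁ (m/n*n≡m 2∣x)
oddPart-even (suc (suc x)) _ | yes 2∣x with 2 ∣? (suc (suc x) / 2)
... | no  _   = inj₁ (m/n*n≡m 2∣x)
... | yes 2∣h =
  inj₂ (≤-trans (*-monoˡ-≤ 4 (halveAll-≤ x (h / 2))) (≤-reflexive quarter*4≡x))
  where
  h : ℕ
  h = suc (suc x) / 2
  quarter*4≡x : h / 2 * 4 ≡ suc (suc x)
  quarter*4≡x = begin
    h / 2 * 4       ≡⟨ solve 1 (λ a → a :* con 4 := (a :* con 2) :* con 2) refl (h / 2) ⟩
    h / 2 * 2 * 2   ≡⟨ cong (_* 2) (m/n*n≡m 2∣h) ⟩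
    h * 2           ≡⟨ m/n*n≡m 2∣x ⟩
    suc (suc x)     ∎
    where open ≡-Reasoning

odd⇒2∣3m+1 : ∀ m → Odd m → 2 ∣ 3 * m + 1
odd⇒2∣3m+1 zero          odd = ⊥-elim (odd (divides 0 refl))
odd⇒2∣3m+1 (suc zero)    _   = divides 2 refl
odd⇒2∣3m+1 (suc (suc m)) odd =
  subst (2 ∣_) 6+3m+1≡3[2+m]+1 (∣m∣n⇒∣m+n (divides 3 refl) (odd⇒2∣3m+1 m odd-m))
  where
  odd-m : Odd m
  odd-m 2∣m = odd (subst (2 ∣_) (+-comm m 2) (∣m∣n⇒∣m+n 2∣m (divides 1 refl)))
  6+3m+1≡3[2+m]+1 : 6 + (3 * m + 1) ≡ 3 * (2 + m) + 1
  6+3m+1≡3[2+m]+1 =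
    solve 1 (λ m → con 6 :+ (con 3 :* m :+ con 1) := con 3 :* (con 2 :+ m) :+ con 1) refl m

S-dichotomy : ∀ m → Odd m → S m * 2 ≡ 3 * m + 1 ⊎ S m * 4 ≤ 3 * m + 1
S-dichotomy m odd = oddPart-even (3 * m + 1) (odd⇒2∣3m+1 m odd)

S*2≤3m+1 : ∀ m → Odd m → S m * 2 ≤ 3 * m + 1
S*2≤3m+1 m odd with S-dichotomy m odd
... | inj₁ S*2≡ = ≤-reflexive S*2≡
... | inj₂ S*4≤ = ≤-trans (*-monoʳ-≤ (S m) (s≤s (s≤s z≤n))) S*4≤

ascent⇒S*2≡3m+1 : ∀ m → Odd m → m < S m → S m * 2 ≡ 3 * m + 1
ascent⇒S*2≡3m+1 m odd m<Sm with S-dichotomy m odd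
... | inj₁ S*2≡ = S*2≡
... | inj₂ S*4≤ = ⊥-elim (<-irrefl refl (begin-strict
  S m * 4               ≤⟨ S*4≤ ⟩
  3 * m + 1             <⟨ m<m+n (3 * m + 1) z<s ⟩
  3 * m + 1 + (3 + m)   ≡⟨ 3m+1+[3+m]≡[1+m]*4 ⟩
  suc m * 4             ≤⟨ *-monoˡ-≤ 4 m<Sm ⟩
  S m * 4               ∎))
  where
  open ≤-Reasoning
  3m+1+[3+m]≡[1+m]*4 : 3 * m + 1 + (3 + m) ≡ suc m * 4
  3m+1+[3+m]≡[1+m]*4 =
    solve 1 (λ m → con 3 :* m :+ con 1 :+ (con 3 :+ m) := (con 1 :+ m) :* con 4) refl m

S<S-below-ascent : ∀ a m → Odd a → Odd m → m < S m → a < m → S a < S m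
S<S-below-ascent a m odd-a odd-m m<Sm a<m = *-cancelʳ-< 2 (S a) (S m) (begin-strict
  S a * 2     ≤⟨ S*2≤3m+1 a odd-a ⟩
  3 * a + 1   <⟨ +-monoˡ-< 1 (*-monoʳ-< 3 a<m) ⟩
  3 * m + 1   ≡⟨ sym (ascent⇒S*2≡3m+1 m odd-m m<Sm) ⟩
  S m * 2     ∎)
  where open ≤-Reasoning

HasPattern-< : ∀ {n} {x : Fin n → ℕ} (σ : Permutation′ n) → HasPattern x σ →
               ∀ i j → toℕ (σ ⟨$⟩ʳ i) < toℕ (σ ⟨$⟩ʳ j) → x i < x j
HasPattern-< σ (_ , _ , increasing , x≡y∘σ) i j σi<σj =
  subst₂ _<_ (sym (x≡y∘σ i)) (sym (x≡y∘σ j)) (increasing _ _ σi<σj)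

mainTheorem14 : ∀ (n : ℕ) → 4 ≤ n →
    ∃ λ (τ : Permutation′ n) →
    ¬ (∃ λ (m : ℕ) → 0 < m × Odd m × HasPattern (orbitTuple n m) τ)
mainTheorem14 (suc (suc (suc (suc k)))) (s≤s (s≤s (s≤s (s≤s _)))) =
  cycle , λ (m , _ , odd , has-τ) →
  let x2<x0 : S (S m) < m
      x2<x0 = HasPattern-< cycle has-τ 2F 0F z<s
      x0<x1 : m < S m
      x0<x1 = HasPattern-< cycle has-τ 0F 1F (s≤s z<s)
      x1<x3 : S m < S (S (S m))
      x1<x3 = HasPattern-< cycle has-τ 1F 3F (s≤s (s≤s z<s))
  in <-asym (S<S-below-ascent (S (S m)) m (S-odd (S m)) odd x0<x1 x2<x0) x1<x3
  where
  cycle : Permutation′ (4 + k)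
  cycle = transpose 0F 1F ∘ₚ transpose 0F 2F
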